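{- Let $r\le n$ and let $T$ be an $(r\times n, n)$-near triple array. Let $T'$ be the row-column design obtained from $T$ by deleting any one column. Then $T'$ is an $(r\times(n-1), n)$-near triple array.
   Context: An $r\times c$ row-column design on $v$ symbols is an $r\times c$ array each of whose cells is filled with one of $v$ symbols. It is binary if no symbol occurs more than once in any row or in any column. Let $e=rc/v$, $e^-=\lfloor e\rfloor$, $e^+=\lceil e\rceil$. The design is equireplicate if $e$ is an integer and every symbol occurs exactly $e$ times, and near equireplicate if $e$ is not an integer and every symbol occurs $e^-$ or $e^+$ times. For a binary design with $r,c\ge2$, let $R_i$, $C_j$ be the symbol sets of row $i$ and column $j$, and put $\lambda_{rc}=\frac{1}{rc}\sum_{i,j}|R_i\cap C_j|$, $\lambda_{rr}=\binom{r}{2}^{ -1}\sum_{i<j}|R_i\cap R_j|$, $\lambda_{cc}=\binom{c}{2}^{ -1}\sum_{i<j}|C_i\cap C_j|$; for real $x$, $x^-=\lfloor x\rfloor$, $x^+=\lceil x\rceil$. An $(r\times c,v)$-near triple array is a binary $r\times c$ row-column design on $v$ symbols which is equireplicate or near equireplicate and in which every row and column share $\lambda_{rc}^-$ or $\lambda_{rc}^+$ symbols, every two distinct rows share $\lambda_{rr}^-$ or $\lambda_{rr}^+$ symbols, and every two distinct columns share $\lambda_{cc}^-$ or $\lambda_{cc}^+$ symbols. (An $(r\times n,n)$-near triple array is the same as an $r\times n$ Latin rectangle in which any two columns share $\lfloor\lambda_{cc}\rfloor$ or $\lceil\lambda_{cc}\rceil$ symbols.) -}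

module Defs where

open import Data.Nat using (ℕ; zero; suc; _+_; _*_; _≤_; _<_; _/_)
open import Data.Nat.Combinatorics using (_C_)
open import Data.Fin using (Fin; toℕ; punchIn)
open import Data.Fin.Properties using (any?)
open import Data.Fin.Subset using (Subset; _∩_; ∣_∣)
open import Data.Vec using (tabulate)
open import Data.Bool using (if_then_else_)
open import Data.Product using (_×_; ∃)
open import Data.Sum using (_⊎_)
open import Relation.Binary.PropositionalEquality using (_≡_; _≢_)
open import Relation.Nullary using (does)
import Data.Nat as ℕ
import Data.Fin as F

Design : ℕ → ℕ → ℕ → Set
Design r c v = Fin r → Fin c → Fin v

sumFin : (n : ℕ) → (Fin n → ℕ) → ℕ
sumFin zero    f = 0
sumFin (suc n) f = f Fin.zero + sumFin n (λ i → f (Fin.suc i))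

sumPairs : (n : ℕ) → (Fin n → Fin n → ℕ) → ℕ
sumPairs n f = sumFin n (λ i → sumFin n (λ j → if does (toℕ i ℕ.<? toℕ j) then f i j else 0))

-- floor and ceiling of the rational S / D (D > 0); value 0 for D = 0 (never used).
floorDiv : ℕ → ℕ → ℕ
floorDiv S zero    = 0
floorDiv S (suc d) = S / suc d

ceilDiv : ℕ → ℕ → ℕ
ceilDiv S zero    = 0
ceilDiv S (suc d) = (S + d) / suc d

NearValue : ℕ → ℕ → ℕ → Set
NearValue x S D = x ≡ floorDiv S D ⊎ x ≡ ceilDiv S D

module _ {r c v : ℕ} (T : Design r c v) where

  Binary : Set
  Binary = (∀ i j j' → T i j ≡ T i j' → j ≡ j')
         × (∀ i i' j → T i j ≡ T i' j → i ≡ i')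

  replication : Fin v → ℕ
  replication s = sumFin r (λ i → sumFin c (λ j → if does (T i j F.≟ s) then 1 else 0))

  RowSet : Fin r → Subset v
  RowSet i = tabulate (λ s → does (any? (λ j → T i j F.≟ s)))

  ColSet : Fin c → Subset v
  ColSet j = tabulate (λ s → does (any? (λ i → T i j F.≟ s)))

  -- λ_rc = Src / (r c), λ_rr = Srr / (r choose 2), λ_cc = Scc / (c choose 2)
  Src : ℕ
  Src = sumFin r (λ i → sumFin c (λ j → ∣ RowSet i ∩ ColSet j ∣))

  Srr : ℕ
  Srr = sumPairs r (λ i i' → ∣ RowSet i ∩ RowSet i' ∣)

  Scc : ℕ
  Scc = sumPairs c (λ j j' → ∣ ColSet j ∩ ColSet j' ∣)

  record IsNearTripleArray : Set where
    field
      rows≥2    : 2 ≤ r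
      cols≥2    : 2 ≤ c
      binary    : Binary
      replicate : ∀ s → NearValue (replication s) (r * c) v
      rowCol    : ∀ i j → NearValue ∣ RowSet i ∩ ColSet j ∣ Src (r * c)
      rowRow    : ∀ i i' → i ≢ i' → NearValue ∣ RowSet i ∩ RowSet i' ∣ Srr (r C 2)
      colCol    : ∀ j j' → j ≢ j' → NearValue ∣ ColSet j ∩ ColSet j' ∣ Scc (c C 2)

deleteColumn : ∀ {r m v} → Design r (suc m) v → Fin (suc m) → Design r m v
deleteColumn T k i j = T i (punchIn k j)

-- In a Latin rectangle every row contains every symbol, so after deleting column k row i holds
-- exactly the symbols other than T i k. Hence two rows share n − 2 symbols, row i and column j
-- share r or r − 1 symbols (according as T i k lies outside or inside column j), every symbol
-- occurs r or r − 1 times, and two columns share as many symbols as they did in T, which is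
-- one of two consecutive values. When a family of naturals takes only the values a and a + 1,
-- each member is the floor or the ceiling of its mean: for N members the total lies between a·N
-- and (a + 1)·N, strictly so on the side away from that member.

module Submission where

open import Defs
open import Data.Bool using (true; false; if_then_else_)
open import Data.Fin using (Fin; zero; suc; toℕ; punchIn; _≟_)
open import Data.Fin.Properties
  using (any?; ¬Fin0; punchInᵢ≢i; punchIn-injective; punchIn-punchOut; toℕ-injective)
  renaming (suc-injective to Fin-suc-injective)
open import Data.Fin.Subset
  using (Subset; inside; outside; ⊤; ⊥; _∈_; _∉_; _⊆_; _∩_; _─_; _-_; ∣_∣)
open import Data.Fin.Subset.Properties
  using (∈⊤; ∣⊤∣≡n; ∣⊥∣≡0; ∣p∣≡n⇒p≡⊤; Empty-unique; ⊆-antisym; ∩-comm; ∩-identityˡ;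
         p─⊥≡p; p─q⊆p; x∈p∧x≢y⇒x∈p-y; _∈?_)
open import Data.Nat using (ℕ; zero; suc; _+_; _*_; _/_; _%_; _≤_; _<_; _>_; _<ᵇ_; z≤n; s≤s)
open import Data.Nat.Combinatorics using (_C_; nC1≡n; nCk+nC[k+1]≡[n+1]C[k+1])
open import Data.Nat.DivMod using (m≡m%n+[m/n]*n; m%n<n; m*n/n≡m; m/n*n≤m; m<n*o⇒m/o<n; /-monoˡ-≤)
open import Data.Nat.Properties hiding (_≟_)
open import Algebra.Properties.CommutativeMonoid.Sum +-0-commutativeMonoid
  using (sum; sum-remove; ∑-distrib-+; ∑-comm; sum-cong-≗)
open import Data.Product using (_×_; _,_; proj₁; proj₂; ∃)
open import Data.Sum using (_⊎_; inj₁; inj₂)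
open import Data.Unit using (tt) renaming (⊤ to Unit)
open import Data.Vec using (_∷_; tabulate; here; there)
open import Data.Vec.Properties using (lookup∘tabulate; lookup⇒[]=; []=⇒lookup)
open import Function using (_∘_)
open import Function.Definitions using (Injective)
open import Relation.Binary.Definitions using (Tri; tri<; tri≈; tri>)
open import Relation.Binary.PropositionalEquality
open import Relation.Nullary using (does; yes; no; contradiction)
open import Relation.Nullary.Reflects using (ofʸ; ofⁿ)
open import Relation.Nullary.Decidable using (dec-true; dec-false)

floorDiv-unique : ∀ D {a S} → a * D ≤ S → S < suc a * D → floorDiv S D ≡ a
floorDiv-unique zero    {a} {S} _ S<0 = contradiction (subst (S <_) (*-zeroʳ a) S<0) n≮0
floorDiv-unique (suc d) {a} {S} lo hi = ≤-antisym
  (≤-pred (m<n*o⇒m/o<n hi))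
  (subst (_≤ S / suc d) (m*n/n≡m a (suc d)) (/-monoˡ-≤ (suc d) lo))

ceilDiv-unique : ∀ D {a S} → a * D < S → S ≤ suc a * D → ceilDiv S D ≡ suc a
ceilDiv-unique zero    lo hi = contradiction (<-≤-trans lo hi) (<-irrefl refl)
ceilDiv-unique (suc d) {a} {S} lo hi = floorDiv-unique (suc d) lo′ hi′
  where
  open ≤-Reasoning
  lo′ : suc a * suc d ≤ S + d
  lo′ = begin
    suc d + a * suc d    ≡⟨ +-comm (suc d) _ ⟩
    a * suc d + suc d    ≡⟨ +-suc _ d ⟩
    suc (a * suc d) + d  ≤⟨ +-monoˡ-≤ d lo ⟩
    S + d                ∎
  hi′ : S + d < suc (suc a) * suc d
  hi′ = begin-strict
    S + d                      <⟨ +-mono-≤-< hi (n<1+n d) ⟩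
    suc a * suc d + suc d      ≡⟨ +-comm _ (suc d) ⟩
    suc (suc a) * suc d        ∎

ceilDiv-exact : ∀ a d → ceilDiv (a * suc d) (suc d) ≡ a
ceilDiv-exact a d = floorDiv-unique (suc d) (m≤m+n _ d) (begin-strict
    a * suc d + d      <⟨ +-monoʳ-< (a * suc d) (n<1+n d) ⟩
    a * suc d + suc d  ≡⟨ +-comm _ (suc d) ⟩
    suc a * suc d      ∎)
  where open ≤-Reasoning

m<[1+m/n]*n : ∀ m d → m < suc (m / suc d) * suc d
m<[1+m/n]*n m d = begin-strict
  m                                  ≡⟨ m≡m%n+[m/n]*n m (suc d) ⟩
  m % suc d + m / suc d * suc d      <⟨ +-monoˡ-< _ (m%n<n m (suc d)) ⟩
  suc (m / suc d) * suc d            ∎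
  where open ≤-Reasoning

ceilDiv≡floorDiv⊎1+floorDiv : ∀ S D → ceilDiv S D ≡ floorDiv S D ⊎ ceilDiv S D ≡ suc (floorDiv S D)
ceilDiv≡floorDiv⊎1+floorDiv S zero = inj₁ refl
ceilDiv≡floorDiv⊎1+floorDiv S (suc d) with m≤n⇒m<n∨m≡n (m/n*n≤m S (suc d))
... | inj₁ q*D<S = inj₂ (ceilDiv-unique (suc d) q*D<S (<⇒≤ (m<[1+m/n]*n S d)))
... | inj₂ q*D≡S =
  inj₁ (trans (cong (λ S → ceilDiv S (suc d)) (sym q*D≡S)) (ceilDiv-exact (S / suc d) d))

nearValue⇒floorDiv⊎1+floorDiv : ∀ {x S D} → NearValue x S D → x ≡ floorDiv S D ⊎ x ≡ suc (floorDiv S D)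
nearValue⇒floorDiv⊎1+floorDiv (inj₁ x≡floor) = inj₁ x≡floor
nearValue⇒floorDiv⊎1+floorDiv {S = S} {D} (inj₂ x≡ceil) with ceilDiv≡floorDiv⊎1+floorDiv S D
... | inj₁ ceil≡floor   = inj₁ (trans x≡ceil ceil≡floor)
... | inj₂ ceil≡1+floor = inj₂ (trans x≡ceil ceil≡1+floor)

nearValue-exact : ∀ {x a d} → NearValue x (a * suc d) (suc d) → x ≡ a
nearValue-exact {a = a} {d} (inj₁ x≡floor) = trans x≡floor (m*n/n≡m a (suc d))
nearValue-exact {a = a} {d} (inj₂ x≡ceil)  = trans x≡ceil (ceilDiv-exact a d)

m≤1∧m+n≡1+o⇒n≡o⊎n≡1+o : ∀ {m n o} → m ≤ 1 → m + n ≡ suc o → n ≡ o ⊎ n ≡ suc o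
m≤1∧m+n≡1+o⇒n≡o⊎n≡1+o z≤n       m+n≡1+o = inj₂ m+n≡1+o
m≤1∧m+n≡1+o⇒n≡o⊎n≡1+o (s≤s z≤n) m+n≡1+o = inj₁ (suc-injective m+n≡1+o)

sumFin≡sum : ∀ n (f : Fin n → ℕ) → sumFin n f ≡ sum f
sumFin≡sum zero    f = refl
sumFin≡sum (suc n) f = cong (f zero +_) (sumFin≡sum n (f ∘ suc))

sumFin-cong : ∀ n {f g : Fin n → ℕ} → (∀ i → f i ≡ g i) → sumFin n f ≡ sumFin n g
sumFin-cong zero    f≗g = refl
sumFin-cong (suc n) f≗g = cong₂ _+_ (f≗g zero) (sumFin-cong n (f≗g ∘ suc))

sumFin-const : ∀ n b → sumFin n (λ _ → b) ≡ n * b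
sumFin-const zero    b = refl
sumFin-const (suc n) b = cong (b +_) (sumFin-const n b)

sumFin-remove : ∀ n (k : Fin (suc n)) (f : Fin (suc n) → ℕ) →
                sumFin (suc n) f ≡ f k + sumFin n (f ∘ punchIn k)
sumFin-remove n k f = begin
  sumFin (suc n) f              ≡⟨ sumFin≡sum (suc n) f ⟩
  sum f                         ≡⟨ sum-remove {i = k} f ⟩
  f k + sum (f ∘ punchIn k)     ≡⟨ cong (f k +_) (sumFin≡sum n (f ∘ punchIn k)) ⟨
  f k + sumFin n (f ∘ punchIn k) ∎
  where open ≡-Reasoning

sumFin-distrib-+ : ∀ n (f g : Fin n → ℕ) → sumFin n (λ i → f i + g i) ≡ sumFin n f + sumFin n g
sumFin-distrib-+ n f g = begin
  sumFin n (λ i → f i + g i)  ≡⟨ sumFin≡sum n _ ⟩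
  sum (λ i → f i + g i)       ≡⟨ ∑-distrib-+ f g ⟩
  sum f + sum g               ≡⟨ cong₂ _+_ (sumFin≡sum n f) (sumFin≡sum n g) ⟨
  sumFin n f + sumFin n g     ∎
  where open ≡-Reasoning

sumFin-comm : ∀ a b (f : Fin a → Fin b → ℕ) →
              sumFin a (λ i → sumFin b (f i)) ≡ sumFin b (λ j → sumFin a (λ i → f i j))
sumFin-comm a b f = begin
  sumFin a (λ i → sumFin b (f i))            ≡⟨ sumFin²≡sum² a b f ⟩
  sum (λ i → sum (f i))                      ≡⟨ ∑-comm f ⟩
  sum (λ j → sum (λ i → f i j))              ≡⟨ sumFin²≡sum² b a (λ j i → f i j) ⟨
  sumFin b (λ j → sumFin a (λ i → f i j))    ∎
  where
  open ≡-Reasoning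
  sumFin²≡sum² : ∀ a b (f : Fin a → Fin b → ℕ) → sumFin a (λ i → sumFin b (f i)) ≡ sum (λ i → sum (f i))
  sumFin²≡sum² a b f = trans (sumFin≡sum a _) (sum-cong-≗ (λ i → sumFin≡sum b (f i)))

sumFin-mono-≤ : ∀ n {f g : Fin n → ℕ} → (∀ i → f i ≤ g i) → sumFin n f ≤ sumFin n g
sumFin-mono-≤ zero    f≤g = z≤n
sumFin-mono-≤ (suc n) f≤g = +-mono-≤ (f≤g zero) (sumFin-mono-≤ n (f≤g ∘ suc))

sumFin-mono-< : ∀ n {f g : Fin n → ℕ} → (∀ i → f i ≤ g i) → ∀ i → f i < g i → sumFin n f < sumFin n g
sumFin-mono-< (suc n) f≤g zero    fi<gi = +-mono-<-≤ fi<gi (sumFin-mono-≤ n (f≤g ∘ suc))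
sumFin-mono-< (suc n) f≤g (suc i) fi<gi = +-mono-≤-< (f≤g zero) (sumFin-mono-< n (f≤g ∘ suc) i fi<gi)

n+nC2≡[1+n]C2 : ∀ n → n + n C 2 ≡ suc n C 2
n+nC2≡[1+n]C2 n = trans (cong (_+ n C 2) (sym (nC1≡n n))) (nCk+nC[k+1]≡[n+1]C[k+1] n 1)

sumPairs-const : ∀ n b → sumPairs n (λ _ _ → b) ≡ (n C 2) * b
sumPairs-const zero    b = refl
sumPairs-const (suc n) b = begin
  sumFin n (λ _ → b) + sumPairs n (λ _ _ → b)
    ≡⟨ cong₂ _+_ (sumFin-const n b) (sumPairs-const n b) ⟩
  n * b + (n C 2) * b
    ≡⟨ *-distribʳ-+ b n (n C 2) ⟨
  (n + n C 2) * b
    ≡⟨ cong (_* b) (n+nC2≡[1+n]C2 n) ⟩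
  (suc n C 2) * b
    ∎
  where open ≡-Reasoning

-- Two-valued families and their means

-- A sum over the size points of Support, axiomatised by what the mean-value argument needs.
record Summation (I : Set) : Set₁ where
  field
    Support  : I → Set
    ∑        : (I → ℕ) → ℕ
    size     : ℕ
    ∑-const  : ∀ b → ∑ (λ _ → b) ≡ b * size
    ∑-mono-≤ : ∀ {f g : I → ℕ} → (∀ {i} → Support i → f i ≤ g i) → ∑ f ≤ ∑ g
    ∑-mono-< : ∀ {f g : I → ℕ} → (∀ {i} → Support i → f i ≤ g i) →
               ∀ {i} → Support i → f i < g i → ∑ f < ∑ g

module _ {I : Set} (Σ : Summation I) (f : I → ℕ) (a : ℕ)
         (two-valued : ∀ {i} → Summation.Support Σ i → f i ≡ a ⊎ f i ≡ suc a) where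

  open Summation Σ

  private
    a≤f : ∀ {i} → Support i → a ≤ f i
    a≤f i∈ with two-valued i∈
    ... | inj₁ fi≡a   = ≤-reflexive (sym fi≡a)
    ... | inj₂ fi≡1+a = subst (a ≤_) (sym fi≡1+a) (n≤1+n a)

    f≤1+a : ∀ {i} → Support i → f i ≤ suc a
    f≤1+a i∈ with two-valued i∈
    ... | inj₁ fi≡a   = subst (_≤ suc a) (sym fi≡a) (n≤1+n a)
    ... | inj₂ fi≡1+a = ≤-reflexive fi≡1+a

  two-valued⇒nearValue : ∀ {i} → Support i → NearValue (f i) (∑ f) size
  two-valued⇒nearValue {i} i∈ with two-valued i∈
  ... | inj₁ fi≡a = inj₁ (trans fi≡a (sym (floorDiv-unique size
          (subst (_≤ ∑ f) (∑-const a) (∑-mono-≤ a≤f))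
          (subst (∑ f <_) (∑-const (suc a)) (∑-mono-< f≤1+a i∈ (s≤s (≤-reflexive fi≡a)))))))
  ... | inj₂ fi≡1+a = inj₂ (trans fi≡1+a (sym (ceilDiv-unique size
          (subst (_< ∑ f) (∑-const a) (∑-mono-< a≤f i∈ (≤-reflexive (sym fi≡1+a))))
          (subst (∑ f ≤_) (∑-const (suc a)) (∑-mono-≤ f≤1+a)))))

sumFin-summation : ∀ n → Summation (Fin n)
sumFin-summation n = record
  { Support  = λ _ → Unit
  ; ∑        = sumFin n
  ; size     = n
  ; ∑-const  = λ b → trans (sumFin-const n b) (*-comm n b)
  ; ∑-mono-≤ = λ f≤g → sumFin-mono-≤ n (λ _ → f≤g tt)
  ; ∑-mono-< = λ f≤g {i} _ → sumFin-mono-< n (λ _ → f≤g tt) i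
  }

grid-summation : ∀ r c → Summation (Fin r × Fin c)
grid-summation r c = record
  { Support  = λ _ → Unit
  ; ∑        = λ f → sumFin r (λ i → sumFin c (λ j → f (i , j)))
  ; size     = r * c
  ; ∑-const  = λ b → trans (sumFin-cong r (λ _ → sumFin-const c b))
                       (trans (sumFin-const r (c * b)) (trans (sym (*-assoc r c b)) (*-comm (r * c) b)))
  ; ∑-mono-≤ = λ f≤g → sumFin-mono-≤ r (λ i → sumFin-mono-≤ c (λ j → f≤g tt))
  ; ∑-mono-< = λ f≤g {p} _ fp<gp → sumFin-mono-< r (λ i → sumFin-mono-≤ c (λ j → f≤g tt)) (proj₁ p)
                                    (sumFin-mono-< c (λ j → f≤g tt) (proj₂ p) fp<gp)
  }

Ascending : ∀ {n} → Fin n × Fin n → Set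
Ascending (i , j) = toℕ i < toℕ j

-- sumPairs n f is, by definition, the grid sum of restrict-ascending (uncurry f).
restrict-ascending : ∀ {n} → (Fin n × Fin n → ℕ) → Fin n × Fin n → ℕ
restrict-ascending f (i , j) = if toℕ i <ᵇ toℕ j then f (i , j) else 0

restrict-ascending-mono-≤ : ∀ {n} {f g : Fin n × Fin n → ℕ} → (∀ {p} → Ascending p → f p ≤ g p) →
                            ∀ p → restrict-ascending f p ≤ restrict-ascending g p
restrict-ascending-mono-≤ f≤g (i , j) with toℕ i <ᵇ toℕ j | <ᵇ-reflects-< (toℕ i) (toℕ j)
... | true  | ofʸ i<j = f≤g i<j
... | false | ofⁿ _   = z≤n

restrict-ascending-mono-< : ∀ {n} {f g : Fin n × Fin n → ℕ} {p} → Ascending p → f p < g p →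
                            restrict-ascending f p < restrict-ascending g p
restrict-ascending-mono-< {p = i , j} i<j fp<gp with toℕ i <ᵇ toℕ j | <ᵇ-reflects-< (toℕ i) (toℕ j)
... | true  | ofʸ _   = fp<gp
... | false | ofⁿ i≮j = contradiction i<j i≮j

pairs-summation : ∀ n → Summation (Fin n × Fin n)
pairs-summation n = record
  { Support  = Ascending
  ; ∑        = λ f → sumPairs n (λ i j → f (i , j))
  ; size     = n C 2
  ; ∑-const  = λ b → trans (sumPairs-const n b) (*-comm (n C 2) b)
  ; ∑-mono-≤ = λ {f} {g} f≤g → ∑-mono-≤ {restrict-ascending f} {restrict-ascending g}
                                  (λ {p} _ → restrict-ascending-mono-≤ f≤g p)
  ; ∑-mono-< = λ {f} {g} f≤g {p} p∈ fp<gp → ∑-mono-< {restrict-ascending f} {restrict-ascending g}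
                                               (λ {p} _ → restrict-ascending-mono-≤ f≤g p) {p} tt
                                               (restrict-ascending-mono-< {f = f} {g} p∈ fp<gp)
  }
  where open Summation (grid-summation n n) using (∑-mono-≤; ∑-mono-<)

intersections-nearValue : ∀ {n v} (S : Fin n → Subset v) a →
  (∀ {i j} → i ≢ j → ∣ S i ∩ S j ∣ ≡ a ⊎ ∣ S i ∩ S j ∣ ≡ suc a) →
  ∀ i j → i ≢ j → NearValue ∣ S i ∩ S j ∣ (sumPairs n (λ i j → ∣ S i ∩ S j ∣)) (n C 2)
intersections-nearValue {n} S a two-valued i j i≢j = by-order (<-cmp (toℕ i) (toℕ j))
  where
  near : ∀ {i j} → toℕ i < toℕ j → NearValue ∣ S i ∩ S j ∣ (sumPairs n (λ i j → ∣ S i ∩ S j ∣)) (n C 2)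
  near = two-valued⇒nearValue (pairs-summation n) (λ (i , j) → ∣ S i ∩ S j ∣) a
           (λ i<j → two-valued (<⇒≢ i<j ∘ cong toℕ))
  by-order : Tri (toℕ i < toℕ j) (toℕ i ≡ toℕ j) (toℕ i > toℕ j) →
             NearValue ∣ S i ∩ S j ∣ (sumPairs n (λ i j → ∣ S i ∩ S j ∣)) (n C 2)
  by-order (tri< i<j _ _) = near i<j
  by-order (tri≈ _ i≡j _) = contradiction (toℕ-injective i≡j) i≢j
  by-order (tri> _ _ j<i) = subst (λ x → NearValue x (sumPairs n (λ i j → ∣ S i ∩ S j ∣)) (n C 2))
                                   (cong ∣_∣ (∩-comm (S j) (S i))) (near j<i)

x∈p⇒suc∣p-x∣≡∣p∣ : ∀ {n} {p : Subset n} {x} → x ∈ p → suc ∣ p - x ∣ ≡ ∣ p ∣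
x∈p⇒suc∣p-x∣≡∣p∣ {p = inside  ∷ p} here        = cong (suc ∘ ∣_∣) (p─⊥≡p p)
x∈p⇒suc∣p-x∣≡∣p∣ {p = inside  ∷ p} (there x∈p) = cong suc (x∈p⇒suc∣p-x∣≡∣p∣ x∈p)
x∈p⇒suc∣p-x∣≡∣p∣ {p = outside ∷ p} (there x∈p) = x∈p⇒suc∣p-x∣≡∣p∣ x∈p

x∉p⇒p-x≡p : ∀ {n} {p : Subset n} {x} → x ∉ p → p - x ≡ p
x∉p⇒p-x≡p {p = inside  ∷ p} {zero}  x∉p = contradiction here x∉p
x∉p⇒p-x≡p {p = outside ∷ p} {zero}  x∉p = cong (outside ∷_) (p─⊥≡p p)
x∉p⇒p-x≡p {p = s       ∷ p} {suc x} x∉p = cong (s ∷_) (x∉p⇒p-x≡p (x∉p ∘ there))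

∣p∣≡1+a⇒∣p-x∣≡a⊎1+a : ∀ {n a} {p : Subset n} x → ∣ p ∣ ≡ suc a → ∣ p - x ∣ ≡ a ⊎ ∣ p - x ∣ ≡ suc a
∣p∣≡1+a⇒∣p-x∣≡a⊎1+a {p = p} x ∣p∣≡1+a with x ∈? p
... | yes x∈p = inj₁ (suc-injective (trans (x∈p⇒suc∣p-x∣≡∣p∣ x∈p) ∣p∣≡1+a))
... | no  x∉p = inj₂ (trans (cong ∣_∣ (x∉p⇒p-x≡p x∉p)) ∣p∣≡1+a)

x∉p-x : ∀ {n} (p : Subset n) x → x ∉ p - x
x∉p-x (s ∷ p) zero    ()
x∉p-x (s ∷ p) (suc x) (there x∈p-x) = x∉p-x p x x∈p-x

⊤-x∩p≡p-x : ∀ {n} (x : Fin n) (p : Subset n) → (⊤ - x) ∩ p ≡ p - x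
⊤-x∩p≡p-x zero    (s ∷ p) = cong (outside ∷_) (begin
  (⊤ ─ ⊥) ∩ p  ≡⟨ cong (_∩ p) (p─⊥≡p ⊤) ⟩
  ⊤ ∩ p        ≡⟨ ∩-identityˡ p ⟩
  p            ≡⟨ p─⊥≡p p ⟨
  p ─ ⊥        ∎)
  where open ≡-Reasoning
⊤-x∩p≡p-x (suc x) (s ∷ p) = cong (s ∷_) (⊤-x∩p≡p-x x p)

∣⊤-y-x∣≡n : ∀ {n} {x y : Fin (suc (suc n))} → x ≢ y → ∣ ⊤ - y - x ∣ ≡ n
∣⊤-y-x∣≡n {n} {x} {y} x≢y = suc-injective (suc-injective (begin
  suc (suc ∣ ⊤ - y - x ∣)
    ≡⟨ cong suc (x∈p⇒suc∣p-x∣≡∣p∣ {suc (suc n)} {⊤ - y} (x∈p∧x≢y⇒x∈p-y (∈⊤ {x = x}) x≢y)) ⟩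
  suc ∣ ⊤ - y ∣
    ≡⟨ x∈p⇒suc∣p-x∣≡∣p∣ {suc (suc n)} {⊤} (∈⊤ {x = y}) ⟩
  ∣ ⊤ {suc (suc n)} ∣
    ≡⟨ ∣⊤∣≡n (suc (suc n)) ⟩
  suc (suc n)
    ∎))
  where open ≡-Reasoning

-- RowSet T i and ColSet T j are, by definition, image (T i) and image (λ i → T i j).
image : ∀ {m n} → (Fin m → Fin n) → Subset n
image g = tabulate (λ s → does (any? (λ j → g j ≟ s)))

∈-image⁺ : ∀ {m n} (g : Fin m → Fin n) j → g j ∈ image g
∈-image⁺ g j = lookup⇒[]= (g j) (image g)
  (trans (lookup∘tabulate _ (g j)) (dec-true (any? (λ i → g i ≟ g j)) (j , refl)))

∈-image⁻ : ∀ {m n} {g : Fin m → Fin n} {s} → s ∈ image g → ∃ λ j → g j ≡ s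
∈-image⁻ {g = g} {s} s∈ with any? (λ j → g j ≟ s) | trans (sym (lookup∘tabulate _ s)) ([]=⇒lookup s∈)
... | yes found | _  = found
... | no  _     | ()

image-punchIn : ∀ {m n} {g : Fin (suc m) → Fin n} → Injective _≡_ _≡_ g →
                ∀ k → image (g ∘ punchIn k) ≡ image g - g k
image-punchIn {g = g} g-inj k = ⊆-antisym left⊆right right⊆left
  where
  left⊆right : image (g ∘ punchIn k) ⊆ image g - g k
  left⊆right s∈ with j , refl ← ∈-image⁻ {g = g ∘ punchIn k} s∈ =
    x∈p∧x≢y⇒x∈p-y (∈-image⁺ g _) (punchInᵢ≢i k j ∘ g-inj)
  right⊆left : image g - g k ⊆ image (g ∘ punchIn k)
  right⊆left s∈ with j , refl ← ∈-image⁻ {g = g} (p─q⊆p _ _ s∈) =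
    subst (_∈ image (g ∘ punchIn k)) (cong g (punchIn-punchOut k≢j)) (∈-image⁺ (g ∘ punchIn k) _)
    where
    k≢j : k ≢ j
    k≢j refl = x∉p-x (image g) (g k) s∈

injective⇒∣image∣≡m : ∀ {m n} {g : Fin m → Fin n} → Injective _≡_ _≡_ g → ∣ image g ∣ ≡ m
injective⇒∣image∣≡m {zero} {n} {g} _ =
  trans (cong ∣_∣ (Empty-unique {p = image g} λ (_ , s∈) → ¬Fin0 (proj₁ (∈-image⁻ {g = g} s∈))))
        (∣⊥∣≡0 n)
injective⇒∣image∣≡m {suc m} {g = g} g-inj = begin
  ∣ image g ∣              ≡⟨ x∈p⇒suc∣p-x∣≡∣p∣ (∈-image⁺ g zero) ⟨
  suc ∣ image g - g zero ∣  ≡⟨ cong (suc ∘ ∣_∣) (image-punchIn g-inj zero) ⟨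
  suc ∣ image (g ∘ suc) ∣   ≡⟨ cong suc (injective⇒∣image∣≡m (Fin-suc-injective ∘ g-inj)) ⟩
  suc m                    ∎
  where open ≡-Reasoning

injective⇒image≡⊤ : ∀ {n} {g : Fin n → Fin n} → Injective _≡_ _≡_ g → image g ≡ ⊤
injective⇒image≡⊤ g-inj = ∣p∣≡n⇒p≡⊤ (injective⇒∣image∣≡m g-inj)

δ : ∀ {v} → Fin v → Fin v → ℕ
δ t s = if does (t ≟ s) then 1 else 0

δ-≢ : ∀ {v} {t s : Fin v} → t ≢ s → δ t s ≡ 0
δ-≢ {t = t} {s} t≢s = cong (if_then 1 else 0) (dec-false (t ≟ s) t≢s)

sumFin-δ : ∀ {v} (t : Fin v) → sumFin v (δ t) ≡ 1
sumFin-δ {suc v} zero    = cong suc (trans (sumFin-const v 0) (*-zeroʳ v))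
sumFin-δ {suc v} (suc t) = sumFin-δ t

sumFin-δ-injective : ∀ {m v} {g : Fin m → Fin v} → Injective _≡_ _≡_ g →
                     ∀ s → sumFin m (λ i → δ (g i) s) ≤ 1
sumFin-δ-injective {zero}          _     s = z≤n
sumFin-δ-injective {suc m} {g = g} g-inj s with g zero ≟ s
... | yes refl = s≤s (≤-reflexive (trans
                   (sumFin-cong m (λ i → δ-≢ (λ e → contradiction (g-inj e) λ ())))
                   (trans (sumFin-const m 0) (*-zeroʳ m))))
... | no  _    = sumFin-δ-injective (Fin-suc-injective ∘ g-inj) s

sumFin-replication : ∀ {r c v} (T : Design r c v) → sumFin v (replication T) ≡ r * c
sumFin-replication {r} {c} {v} T = begin
  sumFin v (λ s → sumFin r (λ i → sumFin c (λ j → δ (T i j) s)))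
    ≡⟨ sumFin-comm v r _ ⟩
  sumFin r (λ i → sumFin v (λ s → sumFin c (λ j → δ (T i j) s)))
    ≡⟨ sumFin-cong r (λ i → sumFin-comm v c _) ⟩
  sumFin r (λ i → sumFin c (λ j → sumFin v (δ (T i j))))
    ≡⟨ sumFin-cong r (λ i → sumFin-cong c (λ j → sumFin-δ (T i j))) ⟩
  sumFin r (λ _ → sumFin c (λ _ → 1))
    ≡⟨ sumFin-cong r (λ _ → trans (sumFin-const c 1) (*-identityʳ c)) ⟩
  sumFin r (λ _ → c)
    ≡⟨ sumFin-const r c ⟩
  r * c
    ∎
  where open ≡-Reasoning

replication-deleteColumn : ∀ {r m v} (T : Design r (suc m) v) k s →
  replication T s ≡ sumFin r (λ i → δ (T i k) s) + replication (deleteColumn T k) s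
replication-deleteColumn {r} {m} T k s =
  trans (sumFin-cong r (λ i → sumFin-remove m k (λ j → δ (T i j) s))) (sumFin-distrib-+ r _ _)

-- Deleting a column

row-injective : ∀ {r c v} {T : Design r c v} → Binary T → ∀ i → Injective _≡_ _≡_ (T i)
row-injective bin i = proj₁ bin i _ _

column-injective : ∀ {r c v} {T : Design r c v} → Binary T → ∀ j → Injective _≡_ _≡_ (λ i → T i j)
column-injective bin j = proj₂ bin _ _ j

binary-deleteColumn : ∀ {r m v} {T : Design r (suc m) v} k → Binary T → Binary (deleteColumn T k)
binary-deleteColumn k bin =
  (λ i j j′ → punchIn-injective k j j′ ∘ row-injective bin i) ,
  (λ i i′ j → column-injective bin (punchIn k j))

module _ {r m} {T : Design r (suc m) (suc m)} (bin : Binary T) (k : Fin (suc m)) where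

  private
    T′ = deleteColumn T k

  rowSet-deleteColumn : ∀ i → RowSet T′ i ≡ ⊤ - T i k
  rowSet-deleteColumn i = begin
    image (T i ∘ punchIn k)  ≡⟨ image-punchIn (row-injective bin i) k ⟩
    image (T i) - T i k      ≡⟨ cong (_- T i k) (injective⇒image≡⊤ (row-injective bin i)) ⟩
    ⊤ - T i k                ∎
    where open ≡-Reasoning

  rowSet∩-deleteColumn : ∀ i p → RowSet T′ i ∩ p ≡ p - T i k
  rowSet∩-deleteColumn i p = trans (cong (_∩ p) (rowSet-deleteColumn i)) (⊤-x∩p≡p-x (T i k) p)

  rowSet∩rowSet-deleteColumn : ∀ i i′ → RowSet T′ i ∩ RowSet T′ i′ ≡ ⊤ - T i′ k - T i k
  rowSet∩rowSet-deleteColumn i i′ =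
    trans (rowSet∩-deleteColumn i (RowSet T′ i′)) (cong (_- T i k) (rowSet-deleteColumn i′))

module _ {r m} {T : Design (suc r) (suc (suc m)) (suc (suc m))} (N : IsNearTripleArray T)
         (k : Fin (suc (suc m))) where

  open IsNearTripleArray N

  private
    T′ = deleteColumn T k

  replication-deleteColumn-two-valued : ∀ s → replication T′ s ≡ r ⊎ replication T′ s ≡ suc r
  replication-deleteColumn-two-valued s = m≤1∧m+n≡1+o⇒n≡o⊎n≡1+o
    (sumFin-δ-injective (column-injective binary k) s)
    (trans (sym (replication-deleteColumn T k s)) (nearValue-exact {a = suc r} {suc m} (replicate s)))

  ∣rowSet∩colSet∣-deleteColumn-two-valued : ∀ i j →
    ∣ RowSet T′ i ∩ ColSet T′ j ∣ ≡ r ⊎ ∣ RowSet T′ i ∩ ColSet T′ j ∣ ≡ suc r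
  ∣rowSet∩colSet∣-deleteColumn-two-valued i j =
    subst (λ p → ∣ p ∣ ≡ r ⊎ ∣ p ∣ ≡ suc r) (sym (rowSet∩-deleteColumn binary k i (ColSet T′ j)))
      (∣p∣≡1+a⇒∣p-x∣≡a⊎1+a (T i k) (injective⇒∣image∣≡m (column-injective binary (punchIn k j))))

  ∣rowSet∩rowSet∣-deleteColumn : ∀ {i i′} → i ≢ i′ → ∣ RowSet T′ i ∩ RowSet T′ i′ ∣ ≡ m
  ∣rowSet∩rowSet∣-deleteColumn {i} {i′} i≢i′ =
    trans (cong ∣_∣ (rowSet∩rowSet-deleteColumn binary k i i′))
          (∣⊤-y-x∣≡n (i≢i′ ∘ column-injective binary k))

  replicate-deleteColumn : ∀ s → NearValue (replication T′ s) (suc r * suc m) (suc (suc m))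
  replicate-deleteColumn s =
    subst (λ S → NearValue (replication T′ s) S (suc (suc m))) (sumFin-replication T′)
      (two-valued⇒nearValue (sumFin-summation (suc (suc m))) (replication T′) r
         (λ {s} _ → replication-deleteColumn-two-valued s) {s} tt)

  rowCol-deleteColumn : ∀ i j → NearValue ∣ RowSet T′ i ∩ ColSet T′ j ∣ (Src T′) (suc r * suc m)
  rowCol-deleteColumn i j =
    two-valued⇒nearValue (grid-summation (suc r) (suc m)) (λ (i , j) → ∣ RowSet T′ i ∩ ColSet T′ j ∣) r
      (λ {(i , j)} _ → ∣rowSet∩colSet∣-deleteColumn-two-valued i j) {i , j} tt

  rowRow-deleteColumn : ∀ i i′ → i ≢ i′ → NearValue ∣ RowSet T′ i ∩ RowSet T′ i′ ∣ (Srr T′) (suc r C 2)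
  rowRow-deleteColumn = intersections-nearValue (RowSet T′) m (inj₁ ∘ ∣rowSet∩rowSet∣-deleteColumn)

  colCol-deleteColumn : ∀ j j′ → j ≢ j′ → NearValue ∣ ColSet T′ j ∩ ColSet T′ j′ ∣ (Scc T′) (suc m C 2)
  colCol-deleteColumn = intersections-nearValue (ColSet T′) (floorDiv (Scc T) (suc (suc m) C 2))
    λ {j} {j′} j≢j′ → nearValue⇒floorDiv⊎1+floorDiv {S = Scc T} {D = suc (suc m) C 2}
      (colCol (punchIn k j) (punchIn k j′) (j≢j′ ∘ punchIn-injective k j j′))

lemma5p7 : (r m : ℕ) → r ≤ suc m → 2 ≤ m →
    (T : Design r (suc m) (suc m)) → IsNearTripleArray T →
    (k : Fin (suc m)) → IsNearTripleArray (deleteColumn T k)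
lemma5p7 zero    _       _ _   _ N _ = contradiction (IsNearTripleArray.rows≥2 N) λ ()
lemma5p7 (suc r) zero    _ ()  _ _ _
lemma5p7 (suc r) (suc m) _ 2≤m T N k = record
  { rows≥2    = rows≥2
  ; cols≥2    = 2≤m
  ; binary    = binary-deleteColumn k binary
  ; replicate = replicate-deleteColumn N k
  ; rowCol    = rowCol-deleteColumn N k
  ; rowRow    = rowRow-deleteColumn N k
  ; colCol    = colCol-deleteColumn N k
  }
  where open IsNearTripleArray N
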